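{- The TRS $\mathcal{R}_1$ is incrementally polynomially terminating over $\mathbb{Q}$.
   Context: Signature: constant $\mathsf{0}$, unary $\mathsf{s},\mathsf{f},\mathsf{g}$, binary $\mathsf{h}$; $\mathsf{s}^n(x)$ denotes $n$-fold application of $\mathsf{s}$. $\mathcal{R}_1$ consists of the rules: $\mathsf{s}(\mathsf{0})\to\mathsf{f}(\mathsf{0})$; $\mathsf{s}^2(\mathsf{0})\to\mathsf{f}(\mathsf{s}(\mathsf{0}))$; $\mathsf{s}^7(\mathsf{0})\to\mathsf{f}(\mathsf{s}^2(\mathsf{0}))$; $\mathsf{f}(\mathsf{s}(\mathsf{0}))\to\mathsf{0}$; $\mathsf{f}(\mathsf{s}^2(\mathsf{0}))\to\mathsf{s}^5(\mathsf{0})$; $\mathsf{f}(\mathsf{s}^2(x))\to\mathsf{h}(\mathsf{f}(x),\mathsf{g}(\mathsf{h}(x,x)))$; $\mathsf{f}(\mathsf{g}(x))\to\mathsf{g}(\mathsf{g}(\mathsf{f}(x)))$; $\mathsf{g}(\mathsf{s}(x))\to\mathsf{s}(\mathsf{s}(\mathsf{g}(x)))$; $\mathsf{g}(x)\to\mathsf{h}(x,x)$; $\mathsf{s}(x)\to\mathsf{h}(\mathsf{0},x)$; $\mathsf{s}(x)\to\mathsf{h}(x,\mathsf{0})$; $\mathsf{h}(\mathsf{f}(x),\mathsf{g}(x))\to\mathsf{f}(\mathsf{s}(x))$. With $\mathbb{Q}_0=\{x\in\mathbb{Q}:x\ge0\}$, a polynomial interpretation over $\mathbb{Q}$ consists of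 rational $\delta>0$ and for each $n$-ary symbol $f$ a polynomial $f_\mathbb{Q}\in\mathbb{Q}[x_1,\dots,x_n]$ with $f_\mathbb{Q}(\mathbb{Q}_0^n)\subseteq\mathbb{Q}_0$; its strict order is $x>y$ iff $x-y\ge\delta$ on $\mathbb{Q}_0$ and its weak order is $\ge$ on $\mathbb{Q}_0$. It is strictly (weakly) monotone if each $f_\mathbb{Q}$ is monotone in each argument w.r.t. the strict (weak) order, and (weakly) compatible with a TRS if $[\alpha](\ell)>[\alpha](r)$ ($\ge$) for all rules $\ell\to r$ and assignments $\alpha$ into $\mathbb{Q}_0$. A TRS $\mathcal{R}$ is polynomially terminating over $\mathbb{Q}$ if some strictly monotone polynomial interpretation over $\mathbb{Q}$ is compatible with it. For $n\ge1$, $\mathcal{R}$ is polynomially terminating over $\mathbb{Q}$ in $n$ steps if either $n=1$ and $\mathcal{R}$ is polynomially terminating over $\mathbb{Q}$, or $n>1$ and there are a polynomial interpretation $\mathcal{P}$ over $\mathbb{Q}$ and nonempty $\mathcal{S}\subsetneq\mathcal{R}$ such that $\mathcal{P}$ is weakly and strictly monotone, weakly compatible with all rules of $\mathcal{R}$, compatible with all rules of $\mathcal{S}$, and $\mathcal{R}\setminus\mathcal{S}$ is polynomially terminating over $\mathbb{Q}$ in $n-1$ steps. $\mathcal{R}$ is incrementally polynomially terminating over $\mathbb{Q}$ if this holds for some $n\ge1$. -}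

module Defs where

open import Data.Nat using (ℕ; zero; suc)
open import Data.Fin using (Fin; zero; suc; _≟_)
open import Data.Rational using (ℚ; 0ℚ; _+_; _*_; _-_; _≤_; _<_)
open import Data.Product using (_×_; _,_; ∃; Σ)
open import Data.List using (List; []; _∷_)
open import Data.List.Membership.Propositional using (_∈_)
open import Relation.Nullary using (¬_; yes; no)

data Sym : Set where
  `0 `s `f `g `h : Sym

arity : Sym → ℕ
arity `0 = 0
arity `s = 1
arity `f = 1
arity `g = 1
arity `h = 2

data Term : Set where
  var : ℕ → Term
  𝟎   : Term
  s   : Term → Term
  f   : Term → Term
  g   : Term → Term
  h   : Term → Term → Term

sⁿ : ℕ → Term → Term
sⁿ zero    t = t
sⁿ (suc n) t = s (sⁿ n t)

record Rule : Set where
  constructor _⟶_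
  field
    lhs : Term
    rhs : Term
open Rule public

TRS : Set₁
TRS = Rule → Set

x : Term
x = var 0

R₁-rules : List Rule
R₁-rules =
    (s 𝟎 ⟶ f 𝟎)
  ∷ (sⁿ 2 𝟎 ⟶ f (s 𝟎))
  ∷ (sⁿ 7 𝟎 ⟶ f (sⁿ 2 𝟎))
  ∷ (f (s 𝟎) ⟶ 𝟎)
  ∷ (f (sⁿ 2 𝟎) ⟶ sⁿ 5 𝟎)
  ∷ (f (sⁿ 2 x) ⟶ h (f x) (g (h x x)))
  ∷ (f (g x) ⟶ g (g (f x)))
  ∷ (g (s x) ⟶ s (s (g x)))
  ∷ (g x ⟶ h x x)
  ∷ (s x ⟶ h 𝟎 x)
  ∷ (s x ⟶ h x 𝟎)
  ∷ (h (f x) (g x) ⟶ f (s x))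
  ∷ []

R₁ : TRS
R₁ ρ = ρ ∈ R₁-rules

-- Polynomials in n variables with rational coefficients
-- (every expression denotes an element of ℚ[x₁,…,xₙ] and conversely)

data Poly (n : ℕ) : Set where
  con  : ℚ → Poly n
  pvar : Fin n → Poly n
  _⊕_  : Poly n → Poly n → Poly n
  _⊗_  : Poly n → Poly n → Poly n

evalP : ∀ {n} → Poly n → (Fin n → ℚ) → ℚ
evalP (con c)   v = c
evalP (pvar i)  v = v i
evalP (p ⊕ q)   v = evalP p v + evalP q v
evalP (p ⊗ q)   v = evalP p v * evalP q v

NonNeg : ℚ → Set
NonNeg q = 0ℚ ≤ q

NonNegVec : ∀ {n} → (Fin n → ℚ) → Set
NonNegVec {n} v = ∀ (i : Fin n) → NonNeg (v i)

upd : ∀ {n} → (Fin n → ℚ) → Fin n → ℚ → (Fin n → ℚ)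
upd v i a j with i ≟ j
... | yes _ = a
... | no  _ = v j

record PolyInterp : Set where
  field
    δ        : ℚ
    δ-pos    : 0ℚ < δ
    ⟦_⟧ₛ     : (c : Sym) → Poly (arity c)
    closed   : (c : Sym) (v : Fin (arity c) → ℚ) →
               NonNegVec v → NonNeg (evalP (⟦ c ⟧ₛ) v)
open PolyInterp public

module _ (P : PolyInterp) where

  _≻_ : ℚ → ℚ → Set
  a ≻ b = δ P ≤ a - b

  _≽_ : ℚ → ℚ → Set
  a ≽ b = b ≤ a

  symFun : (c : Sym) → (Fin (arity c) → ℚ) → ℚ
  symFun c = evalP (⟦_⟧ₛ P c)

  StrictlyMonotone : Set
  StrictlyMonotone = ∀ (c : Sym) (i : Fin (arity c)) (v : Fin (arity c) → ℚ) (a b : ℚ) →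
    NonNegVec v → NonNeg a → NonNeg b → a ≻ b →
    symFun c (upd v i a) ≻ symFun c (upd v i b)

  WeaklyMonotone : Set
  WeaklyMonotone = ∀ (c : Sym) (i : Fin (arity c)) (v : Fin (arity c) → ℚ) (a b : ℚ) →
    NonNegVec v → NonNeg a → NonNeg b → a ≽ b →
    symFun c (upd v i a) ≽ symFun c (upd v i b)

  ⟦_⟧[_] : Term → (ℕ → ℚ) → ℚ
  ⟦ var k ⟧[ α ] = α k
  ⟦ 𝟎 ⟧[ α ]     = symFun `0 (λ ())
  ⟦ s t ⟧[ α ]   = symFun `s (λ _ → ⟦ t ⟧[ α ])
  ⟦ f t ⟧[ α ]   = symFun `f (λ _ → ⟦ t ⟧[ α ])
  ⟦ g t ⟧[ α ]   = symFun `g (λ _ → ⟦ t ⟧[ α ])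
  ⟦ h t u ⟧[ α ] = symFun `h (λ { zero → ⟦ t ⟧[ α ] ; (suc _) → ⟦ u ⟧[ α ] })

  Assignment₀ : (ℕ → ℚ) → Set
  Assignment₀ α = ∀ k → NonNeg (α k)

  CompatibleRule : Rule → Set
  CompatibleRule ρ = ∀ α → Assignment₀ α → ⟦ lhs ρ ⟧[ α ] ≻ ⟦ rhs ρ ⟧[ α ]

  WeaklyCompatibleRule : Rule → Set
  WeaklyCompatibleRule ρ = ∀ α → Assignment₀ α → ⟦ lhs ρ ⟧[ α ] ≽ ⟦ rhs ρ ⟧[ α ]

PolyTerminating : TRS → Set
PolyTerminating R = Σ PolyInterp λ P →
  StrictlyMonotone P × (∀ ρ → R ρ → CompatibleRule P ρ)

_∖_ : TRS → TRS → TRS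
(R ∖ S) ρ = R ρ × ¬ S ρ

data PolyTermInSteps : TRS → ℕ → Set₁ where
  one  : ∀ {R} → PolyTerminating R → PolyTermInSteps R 1
  step : ∀ {R n} (P : PolyInterp) (S : TRS) →
         (∀ ρ → S ρ → R ρ) →
         (∃ λ ρ → S ρ) →
         (∃ λ ρ → R ρ × ¬ S ρ) →
         WeaklyMonotone P → StrictlyMonotone P →
         (∀ ρ → R ρ → WeaklyCompatibleRule P ρ) →
         (∀ ρ → S ρ → CompatibleRule P ρ) →
         PolyTermInSteps (R ∖ S) n →
         PolyTermInSteps R (suc n)

IncrementallyPolyTerminating : TRS → Set₁
IncrementallyPolyTerminating R = ∃ λ n → PolyTermInSteps R n

module Submission where

-- 1. The interpretation P₁ (0 ↦ 0, s ↦ y+1, f ↦ y²+y, g ↦ 2y+3, h ↦ x+y)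
--    strictly decreases ten of the twelve rules and weakly decreases the
--    remaining two, s²(0) → f(s(0)) and g(s(x)) → s(s(g(x))), on which
--    both sides have the same value.
-- 2. The interpretation P₂ (0 ↦ 0, s ↦ y+1, f ↦ y, g ↦ 3y, h ↦ x+y)
--    strictly decreases those two remaining rules.

open import Defs
open import Data.Nat using (ℕ)
open import Data.Fin using (Fin; zero; suc)
open import Data.Integer using (+_)
open import Data.Rational using (ℚ; 0ℚ; 1ℚ; _/_; _+_; _*_; _-_; -_; _≤_; nonNegative)
open import Data.Rational.Properties
open import Data.Rational.Solver using (module +-*-Solver)
open import Data.Product using (_×_; _,_; ∃)
open import Data.List using (List; []; _∷_)
open import Data.List.Membership.Propositional using (_∈_; _∉_)
open import Data.List.Relation.Unary.Any using (here; there)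
open import Data.List.Relation.Unary.All using (All; []; _∷_; lookup)
open import Data.List.Relation.Unary.All.Properties using (All¬⇒¬Any)
open import Data.Unit using (tt)
open import Data.Empty using (⊥-elim)
open import Relation.Binary.PropositionalEquality using (_≡_; _≢_; refl; sym; subst)
open +-*-Solver

nonNeg-+ : ∀ {p q} → NonNeg p → NonNeg q → NonNeg (p + q)
nonNeg-+ = +-mono-≤

nonNeg-* : ∀ {p q} → NonNeg p → NonNeg q → NonNeg (p * q)
nonNeg-* {p} {q} 0≤p 0≤q =
  nonNegative⁻¹ _ {{nonNeg*nonNeg⇒nonNeg p {{nonNegative 0≤p}} q {{nonNegative 0≤q}}}}

-- A quantity exceeding d by a nonnegative amount is at least d; most
-- inequalities below are established by exhibiting such an excess.
≤-byExcess : ∀ {p d N} → p ≡ d + N → NonNeg N → d ≤ p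
≤-byExcess {p} {d} {N} p≡d+N 0≤N = subst (d ≤_) (sym p≡d+N)
  (subst (_≤ d + N) (+-identityʳ d) (+-monoʳ-≤ d 0≤N))

≤⇒difference-nonNeg : ∀ {a b} → b ≤ a → NonNeg (a - b)
≤⇒difference-nonNeg {a} {b} b≤a = subst (_≤ a - b) (+-inverseʳ b) (+-monoˡ-≤ (- b) b≤a)

difference-nonNeg⇒≤ : ∀ {a b} → NonNeg (a - b) → b ≤ a
difference-nonNeg⇒≤ {a} {b} = ≤-byExcess (solve 2 (λ a b → a := b :+ (a :- b)) refl a b)

Expanding : PolyInterp → Set
Expanding P = ∀ (c : Sym) (i : Fin (arity c)) (v : Fin (arity c) → ℚ) (a b : ℚ) →
  NonNegVec v → NonNeg a → NonNeg b → b ≤ a →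
  a - b ≤ symFun P c (upd v i a) - symFun P c (upd v i b)

expanding⇒strictlyMonotone : ∀ P → Expanding P → StrictlyMonotone P
expanding⇒strictlyMonotone P expanding c i v a b 0≤v 0≤a 0≤b δ≤a-b =
  ≤-trans δ≤a-b (expanding c i v a b 0≤v 0≤a 0≤b b≤a)
  where
  b≤a : b ≤ a
  b≤a = difference-nonNeg⇒≤ (≤-trans (<⇒≤ (δ-pos P)) δ≤a-b)

expanding⇒weaklyMonotone : ∀ P → Expanding P → WeaklyMonotone P
expanding⇒weaklyMonotone P expanding c i v a b 0≤v 0≤a 0≤b b≤a =
  difference-nonNeg⇒≤ (≤-trans (≤⇒difference-nonNeg b≤a)
                                (expanding c i v a b 0≤v 0≤a 0≤b b≤a))

compatible⇒weaklyCompatible : ∀ P ρ → CompatibleRule P ρ → WeaklyCompatibleRule P ρ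
compatible⇒weaklyCompatible P ρ compatible α 0≤α =
  difference-nonNeg⇒≤ (≤-trans (<⇒≤ (δ-pos P)) (compatible α 0≤α))

data Verdict (P Q : PolyInterp) (W : List Rule) (ρ : Rule) : Set where
  decreasing : ρ ∉ W → CompatibleRule P ρ → Verdict P Q W ρ
  postponed  : ρ ∈ W → WeaklyCompatibleRule P ρ → CompatibleRule Q ρ → Verdict P Q W ρ

-- If every rule of R has a verdict, some rule of R is not postponed and some
-- rule is, then the rules of R terminate in two steps: first P removes the
-- non-postponed rules S, then Q alone handles the remaining ones.
twoStepTermination : (P Q : PolyInterp) (R W : List Rule) →
  WeaklyMonotone P → StrictlyMonotone P → StrictlyMonotone Q →
  All (Verdict P Q W) R →
  (∃ λ ρ → ρ ∈ R × ρ ∉ W) → (∃ λ ρ → ρ ∈ R × ρ ∈ W) →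
  PolyTermInSteps (_∈ R) 2
twoStepTermination P Q R W weakP strictP strictQ verdicts (ρ , ρ∈R , ρ∉W) (ρ′ , ρ′∈R , ρ′∈W) =
  step P S proj-R (ρ , ρ∈R , ρ∉W) (ρ′ , ρ′∈R , λ (_ , ρ′∉W) → ρ′∉W ρ′∈W)
       weakP strictP weaklyDecreasing strictlyDecreasing
       (one (Q , strictQ , remainingDecreasing))
  where
  S : TRS
  S σ = σ ∈ R × σ ∉ W

  proj-R : ∀ σ → S σ → σ ∈ R
  proj-R σ (σ∈R , _) = σ∈R

  weaklyDecreasing : ∀ σ → σ ∈ R → WeaklyCompatibleRule P σ
  weaklyDecreasing σ σ∈R with lookup verdicts σ∈R
  ... | decreasing _ compatible = compatible⇒weaklyCompatible P σ compatible
  ... | postponed _ weak _      = weak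

  strictlyDecreasing : ∀ σ → S σ → CompatibleRule P σ
  strictlyDecreasing σ (σ∈R , σ∉W) with lookup verdicts σ∈R
  ... | decreasing _ compatible = compatible
  ... | postponed σ∈W _ _       = ⊥-elim (σ∉W σ∈W)

  remainingDecreasing : ∀ σ → ((_∈ R) ∖ S) σ → CompatibleRule Q σ
  remainingDecreasing σ (σ∈R , σ∉S) with lookup verdicts σ∈R
  ... | decreasing σ∉W _   = ⊥-elim (σ∉S (σ∈R , σ∉W))
  ... | postponed _ _ strict = strict

2ℚ 3ℚ 10ℚ : ℚ
2ℚ = + 2 / 1
3ℚ = + 3 / 1
10ℚ = + 10 / 1

0≤1 : NonNeg 1ℚ
0≤1 = ≤ᵇ⇒≤ tt

0≤2 : NonNeg 2ℚ
0≤2 = ≤ᵇ⇒≤ tt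

0≤3 : NonNeg 3ℚ
0≤3 = ≤ᵇ⇒≤ tt

0≤10 : NonNeg 10ℚ
0≤10 = ≤ᵇ⇒≤ tt

y : Poly 1
y = pvar zero

𝟎ᴾ : Poly 0
𝟎ᴾ = con 0ℚ

sᴾ : Poly 1
sᴾ = y ⊕ con 1ℚ

hᴾ : Poly 2
hᴾ = pvar zero ⊕ pvar (suc zero)

I₁ : (c : Sym) → Poly (arity c)
I₁ `0 = 𝟎ᴾ
I₁ `s = sᴾ
I₁ `f = (y ⊗ y) ⊕ y
I₁ `g = (con 2ℚ ⊗ y) ⊕ con 3ℚ
I₁ `h = hᴾ

closed₁ : (c : Sym) (v : Fin (arity c) → ℚ) → NonNegVec v → NonNeg (evalP (I₁ c) v)
closed₁ `0 v 0≤v = ≤-refl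
closed₁ `s v 0≤v = nonNeg-+ (0≤v zero) 0≤1
closed₁ `f v 0≤v = nonNeg-+ (nonNeg-* (0≤v zero) (0≤v zero)) (0≤v zero)
closed₁ `g v 0≤v = nonNeg-+ (nonNeg-* 0≤2 (0≤v zero)) 0≤3
closed₁ `h v 0≤v = nonNeg-+ (0≤v zero) (0≤v (suc zero))

P₁ : PolyInterp
P₁ = record { δ = 1ℚ ; δ-pos = positive⁻¹ 1ℚ ; ⟦_⟧ₛ = I₁ ; closed = closed₁ }

I₂ : (c : Sym) → Poly (arity c)
I₂ `0 = 𝟎ᴾ
I₂ `s = sᴾ
I₂ `f = y
I₂ `g = con 3ℚ ⊗ y
I₂ `h = hᴾ

closed₂ : (c : Sym) (v : Fin (arity c) → ℚ) → NonNegVec v → NonNeg (evalP (I₂ c) v)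
closed₂ `0 v 0≤v = ≤-refl
closed₂ `s v 0≤v = nonNeg-+ (0≤v zero) 0≤1
closed₂ `f v 0≤v = 0≤v zero
closed₂ `g v 0≤v = nonNeg-* 0≤3 (0≤v zero)
closed₂ `h v 0≤v = nonNeg-+ (0≤v zero) (0≤v (suc zero))

P₂ : PolyInterp
P₂ = record { δ = 1ℚ ; δ-pos = positive⁻¹ 1ℚ ; ⟦_⟧ₛ = I₂ ; closed = closed₂ }

-- The same operations as expressions for the ring solver.
module Expressions {n : ℕ} where
  sᴱ f₁ᴱ g₁ᴱ f₂ᴱ g₂ᴱ : Polynomial n → Polynomial n
  sᴱ  t = t :+ con 1ℚ
  f₁ᴱ t = t :* t :+ t
  g₁ᴱ t = con 2ℚ :* t :+ con 3ℚ
  f₂ᴱ t = t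
  g₂ᴱ t = con 3ℚ :* t

  𝟎ᴱ : Polynomial n
  𝟎ᴱ = con 0ℚ

  hᴱ : Polynomial n → Polynomial n → Polynomial n
  hᴱ t u = t :+ u
open Expressions

expands-exactly : ∀ a b {F} → F ≡ a - b → a - b ≤ F
expands-exactly _ _ F≡a-b = ≤-reflexive (sym F≡a-b)

expanding₁ : Expanding P₁
expanding₁ `s zero v a b _ _ _ _ =
  expands-exactly a b (solve 2 (λ a b → sᴱ a :- sᴱ b := a :- b) refl a b)
expanding₁ `f zero v a b _ 0≤a 0≤b b≤a =
  ≤-byExcess (solve 2 (λ a b → f₁ᴱ a :- f₁ᴱ b := (a :- b) :+ (a :- b) :* (a :+ b)) refl a b)
             (nonNeg-* (≤⇒difference-nonNeg b≤a) (nonNeg-+ 0≤a 0≤b))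
expanding₁ `g zero v a b _ _ _ b≤a =
  ≤-byExcess (solve 2 (λ a b → g₁ᴱ a :- g₁ᴱ b := (a :- b) :+ (a :- b)) refl a b)
             (≤⇒difference-nonNeg b≤a)
expanding₁ `h zero v a b _ _ _ _ =
  expands-exactly a b (solve 3 (λ a b c → hᴱ a c :- hᴱ b c := a :- b) refl a b (v (suc zero)))
expanding₁ `h (suc zero) v a b _ _ _ _ =
  expands-exactly a b (solve 3 (λ a b c → hᴱ c a :- hᴱ c b := a :- b) refl a b (v zero))

expanding₂ : Expanding P₂
expanding₂ `s zero v a b _ _ _ _ =
  expands-exactly a b (solve 2 (λ a b → sᴱ a :- sᴱ b := a :- b) refl a b)
expanding₂ `f zero v a b _ _ _ _ = ≤-refl
expanding₂ `g zero v a b _ _ _ b≤a =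
  ≤-byExcess (solve 2 (λ a b → g₂ᴱ a :- g₂ᴱ b := (a :- b) :+ con 2ℚ :* (a :- b)) refl a b)
             (nonNeg-* 0≤2 (≤⇒difference-nonNeg b≤a))
expanding₂ `h zero v a b _ _ _ _ =
  expands-exactly a b (solve 3 (λ a b c → hᴱ a c :- hᴱ b c := a :- b) refl a b (v (suc zero)))
expanding₂ `h (suc zero) v a b _ _ _ _ =
  expands-exactly a b (solve 3 (λ a b c → hᴱ c a :- hᴱ c b := a :- b) refl a b (v zero))

f-s²-strict₁ : CompatibleRule P₁ (f (sⁿ 2 x) ⟶ h (f x) (g (h x x)))
f-s²-strict₁ α _ = ≤-byExcess
  (solve 1 (λ y → f₁ᴱ (sᴱ (sᴱ y)) :- hᴱ (f₁ᴱ y) (g₁ᴱ (hᴱ y y)) := con 1ℚ :+ con 2ℚ) refl (α 0))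
  0≤2

f-g-strict₁ : CompatibleRule P₁ (f (g x) ⟶ g (g (f x)))
f-g-strict₁ α 0≤α = ≤-byExcess
  (solve 1 (λ y → f₁ᴱ (g₁ᴱ y) :- g₁ᴱ (g₁ᴱ (f₁ᴱ y)) := con 1ℚ :+ (con 2ℚ :+ con 10ℚ :* y)) refl (α 0))
  (nonNeg-+ 0≤2 (nonNeg-* 0≤10 (0≤α 0)))

g-h-strict₁ : CompatibleRule P₁ (g x ⟶ h x x)
g-h-strict₁ α _ = ≤-byExcess
  (solve 1 (λ y → g₁ᴱ y :- hᴱ y y := con 1ℚ :+ con 2ℚ) refl (α 0))
  0≤2

s-hˡ-strict₁ : CompatibleRule P₁ (s x ⟶ h 𝟎 x)
s-hˡ-strict₁ α _ = ≤-reflexive (sym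
  (solve 1 (λ y → sᴱ y :- hᴱ 𝟎ᴱ y := con 1ℚ) refl (α 0)))

s-hʳ-strict₁ : CompatibleRule P₁ (s x ⟶ h x 𝟎)
s-hʳ-strict₁ α _ = ≤-reflexive (sym
  (solve 1 (λ y → sᴱ y :- hᴱ y 𝟎ᴱ := con 1ℚ) refl (α 0)))

h-f-strict₁ : CompatibleRule P₁ (h (f x) (g x) ⟶ f (s x))
h-f-strict₁ α _ = ≤-reflexive (sym
  (solve 1 (λ y → hᴱ (f₁ᴱ y) (g₁ᴱ y) :- f₁ᴱ (sᴱ y) := con 1ℚ) refl (α 0)))

g-s-weak₁ : WeaklyCompatibleRule P₁ (g (s x) ⟶ s (s (g x)))
g-s-weak₁ α _ = ≤-reflexive
  (solve 1 (λ y → sᴱ (sᴱ (g₁ᴱ y)) := g₁ᴱ (sᴱ y)) refl (α 0))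

g-s-strict₂ : CompatibleRule P₂ (g (s x) ⟶ s (s (g x)))
g-s-strict₂ α _ = ≤-reflexive (sym
  (solve 1 (λ y → g₂ᴱ (sᴱ y) :- sᴱ (sᴱ (g₂ᴱ y)) := con 1ℚ) refl (α 0)))

-- The rules left to the second step: P₁ gives both sides equal values.
postponedRules : List Rule
postponedRules = (sⁿ 2 𝟎 ⟶ f (s 𝟎)) ∷ (g (s x) ⟶ s (s (g x))) ∷ []

notPostponed : ∀ {ρ} → ρ ≢ (sⁿ 2 𝟎 ⟶ f (s 𝟎)) → ρ ≢ (g (s x) ⟶ s (s (g x))) →
               ρ ∉ postponedRules
notPostponed ρ≢w₁ ρ≢w₂ = All¬⇒¬Any (ρ≢w₁ ∷ ρ≢w₂ ∷ [])

-- Ground rules are decided by evaluating both sides, e.g. s(0) ↦ 1 > 0 ↦ f(0).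
verdicts : All (Verdict P₁ P₂ postponedRules) R₁-rules
verdicts =
    decreasing (notPostponed (λ ()) (λ ())) (λ _ _ → ≤ᵇ⇒≤ tt)
  ∷ postponed  (here refl) (λ _ _ → ≤ᵇ⇒≤ tt) (λ _ _ → ≤ᵇ⇒≤ tt)
  ∷ decreasing (notPostponed (λ ()) (λ ())) (λ _ _ → ≤ᵇ⇒≤ tt)
  ∷ decreasing (notPostponed (λ ()) (λ ())) (λ _ _ → ≤ᵇ⇒≤ tt)
  ∷ decreasing (notPostponed (λ ()) (λ ())) (λ _ _ → ≤ᵇ⇒≤ tt)
  ∷ decreasing (notPostponed (λ ()) (λ ())) f-s²-strict₁
  ∷ decreasing (notPostponed (λ ()) (λ ())) f-g-strict₁
  ∷ postponed  (there (here refl)) g-s-weak₁ g-s-strict₂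
  ∷ decreasing (notPostponed (λ ()) (λ ())) g-h-strict₁
  ∷ decreasing (notPostponed (λ ()) (λ ())) s-hˡ-strict₁
  ∷ decreasing (notPostponed (λ ()) (λ ())) s-hʳ-strict₁
  ∷ decreasing (notPostponed (λ ()) (λ ())) h-f-strict₁
  ∷ []

-- Two steps: P₁ removes every rule except the two postponed ones (s(0) → f(0)
-- witnesses that it removes something, s²(0) → f(s(0)) that it does not
-- remove everything), and P₂ then decreases the postponed rules strictly.
lemma6p4 : IncrementallyPolyTerminating R₁
lemma6p4 = 2 , twoStepTermination P₁ P₂ R₁-rules postponedRules
  (expanding⇒weaklyMonotone P₁ expanding₁)
  (expanding⇒strictlyMonotone P₁ expanding₁)
  (expanding⇒strictlyMonotone P₂ expanding₂)
  verdicts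
  ((s 𝟎 ⟶ f 𝟎) , here refl , notPostponed (λ ()) (λ ()))
  ((sⁿ 2 𝟎 ⟶ f (s 𝟎)) , there (here refl) , here refl)
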